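{- Let $T$ be an irreducible two-way-comparison decision tree for an instance $(Q,w,\mathcal C,K)$, let $u$ be a node of $T$, and let $x$ be any allowed test (not necessarily in $T$). Let $T'_x$ be the result of splitting $T_u$ around $x$. Then for each query $q\in Q_u$, the search for $q$ in $T'_x$ ends at a leaf that is one of the two copies in $T'_x$ of the leaf at which the search for $q$ in $T_u$ ends.
   Context: An instance $(Q,w,\mathcal C,K)$ consists of a totally ordered finite set $Q$ of queries with weights $w(q)\ge0$, a collection $\mathcal C\subseteq 2^Q$ of classes, and a set $K\subseteq Q$ of keys; every query belongs to some class. An allowed test is "$q<k$" for some $k\in K$ with $\min Q<k\le\max Q$, or "$q=k$" for some $k\in K$. A two-way-comparison decision tree is a rooted binary tree whose non-leaf nodes are allowed tests, with children labeled by the outcomes yes/no, and whose leaves are labeled by classes, each leaf's class containing every query whose search ends there. The search for $q$ starts at the root and moves to the yes-child if $q$ satisfies the test and to the no-child otherwise; $q$ reaches every node on its search path. $Q_u$ is the set of queries reaching node $u$. The tree is irreducible if for every node $u$, at least one query reaches $u$, and if some class contains all of $Q_u$ then $u$ is a leaf. An edge $u\to v$ to a child is identified with the corresponding outcome at $u$. Two outcomes are consistent if some query in $Q$ satisfies both, otherwise inconsistent. Two tests are equivalent if either they give the same outcome for every $q\in Q$ or opposite outcomes for every $q\in Q$. $T_u$ denotes the subtree of $T$ rooted at $u$. For a downward path $u_1\to u_2\to\cdots$, $u_i'$ denotes the sibling of $u_i$. The $x$-consistent path from $u$ is the maximal downward path from $u$ in $T_u$ such that each outcome along it is consistent with both outcomes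 at $x$. Splitting $T_u$ around $x$: let $u=u_1\to u_2\to\cdots\to u_d$ be the $x$-consistent path from $u$. Initialize $T'_x$ to have root $x$ whose yes- and no-subtrees, $T^{\mathsf{yes}}_u$ and $T^{\mathsf{no}}_u$, are each a copy of $T_u$. For each outcome $\alpha\in\{\mathsf{yes},\mathsf{no}\}$ at $x$, modify $T^{\alpha}_u$ as follows: for each $i\in\{1,\dots,d-1\}$, if the outcome $u_i\to u_{i+1}'$ is inconsistent with the $\alpha$-outcome at $x$, delete (within $T^\alpha_u$) node $u_i$ and the subtree rooted at $u_{i+1}'$, making $u_{i+1}$ the child of $u_i$'s current parent in place of $u_i$. For $i=d$: if $u_d$ is a leaf, stop; otherwise let $u_d\to y'$ be the outcome at $u_d$ inconsistent with the $\alpha$-outcome at $x$, and delete (within $T^\alpha_u$) node $u_d$ and the subtree rooted at $y'$, making the other child $y$ of $u_d$ the child of $u_d$'s current parent in place of $u_d$. -}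

module Defs where

open import Data.Nat using (ℕ; zero; suc; _<_)
open import Data.Fin using (Fin; toℕ; _<?_; _≟_)
open import Data.Fin.Subset using (Subset) renaming (_∈_ to _∈ₛ_)
open import Data.Bool using (Bool; true; false; not; _∧_; if_then_else_)
open import Data.List using (List; []; _∷_; allFin)
open import Data.Bool.ListAction using (any)
open import Data.List.Membership.Propositional using () renaming (_∈_ to _∈ₗ_)
open import Data.List.Relation.Unary.Any using (Any)
open import Data.Product using (Σ; ∃; _×_)
open import Data.Unit using (⊤)
open import Data.Empty using (⊥)
open import Relation.Nullary.Decidable using (⌊_⌋)
open import Relation.Binary.PropositionalEquality using (_≡_)

-- Queries are Q = Fin n with its natural total order (any finite totally
-- ordered set is order-isomorphic to some Fin n).  Weights play no role in
-- the statement and are omitted.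
record Instance (n : ℕ) : Set where
  field
    classes : List (Subset n)
    keys    : Subset n
    covered : (q : Fin n) → Any (q ∈ₛ_) classes

open Instance public

data Test (n : ℕ) : Set where
  lt : Fin n → Test n
  eq : Fin n → Test n

eval : ∀ {n} → Test n → Fin n → Bool
eval (lt k) q = ⌊ q <? k ⌋
eval (eq k) q = ⌊ q ≟ k ⌋

-- Allowed tests for an instance.  For "q < k", k ≤ max Q holds automatically
-- in Fin n, and min Q < k means toℕ k > 0.
Allowed : ∀ {n} → Instance n → Test n → Set
Allowed I (lt k) = (k ∈ₛ keys I) × (0 < toℕ k)
Allowed I (eq k) = k ∈ₛ keys I

-- Binary trees: internal nodes carry tests (first subtree = yes-child,
-- second = no-child), leaves carry labels of type A.
data DTree (n : ℕ) (A : Set) : Set where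
  leaf : A → DTree n A
  node : Test n → DTree n A → DTree n A → DTree n A

search : ∀ {n A} → DTree n A → Fin n → A
search (leaf a) q = a
search (node y l r) q = if eval y q then search l q else search r q

mapLeaves : ∀ {n A B} → (A → B) → DTree n A → DTree n B
mapLeaves f (leaf a) = leaf (f a)
mapLeaves f (node y l r) = node y (mapLeaves f l) (mapLeaves f r)

-- Node addresses: a list of outcomes from the root (true = yes).
Address : Set
Address = List Bool

-- Relabel every leaf by its own address in the tree, so that leaves (and
-- their copies after a transformation) can be identified.
addresses : ∀ {n A} → DTree n A → DTree n Address
addresses (leaf a) = leaf []
addresses (node y l r) =
  node y (mapLeaves (true ∷_) (addresses l)) (mapLeaves (false ∷_) (addresses r))

data At {n A} : DTree n A → Address → DTree n A → Set where
  here  : ∀ {t} → At t [] t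
  yesAt : ∀ {y l r p s} → At l p s → At (node y l r) (true ∷ p) s
  noAt  : ∀ {y l r p s} → At r p s → At (node y l r) (false ∷ p) s

Reaches : ∀ {n A} → DTree n A → Address → Fin n → Set
Reaches t [] q = ⊤
Reaches (leaf a) (_ ∷ _) q = ⊥
Reaches (node y l r) (true ∷ p) q = (eval y q ≡ true) × Reaches l p q
Reaches (node y l r) (false ∷ p) q = (eval y q ≡ false) × Reaches r p q

IsLeaf : ∀ {n A} → DTree n A → Set
IsLeaf (leaf a) = ⊤
IsLeaf (node _ _ _) = ⊥

AllTests : ∀ {n A} → (Test n → Set) → DTree n A → Set
AllTests P (leaf a) = ⊤
AllTests P (node y l r) = P y × AllTests P l × AllTests P r

AllLeaves : ∀ {n A} → (A → Set) → DTree n A → Set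
AllLeaves P (leaf a) = P a
AllLeaves P (node y l r) = AllLeaves P l × AllLeaves P r

IsDecisionTree : ∀ {n} → Instance n → DTree n (Subset n) → Set
IsDecisionTree {n} I T =
  AllTests (Allowed I) T × AllLeaves (_∈ₗ classes I) T ×
  ((q : Fin n) → q ∈ₛ search T q)

Irreducible : ∀ {n} → Instance n → DTree n (Subset n) → Set
Irreducible {n} I T =
  (p : Address) (s : DTree n (Subset n)) → At T p s →
    (∃ λ q → Reaches T p q) ×
    ((Σ (Subset n) λ c → (c ∈ₗ classes I) × ((q : Fin n) → Reaches T p q → q ∈ₛ c)) →
       IsLeaf s)

consistent : ∀ {n} → Test n → Bool → Test n → Bool → Bool
consistent {n} y b x a =
  any (λ q → ⌊ eval y q Data.Bool.≟ b ⌋ ∧ ⌊ eval x q Data.Bool.≟ a ⌋) (allFin n)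

bothConsistent : ∀ {n} → Test n → Bool → Test n → Bool
bothConsistent y b x = consistent y b x true ∧ consistent y b x false

-- The copy T^α_u (α = a) of a tree, modified along the x-consistent path.
splitCopy : ∀ {n A} → Test n → Bool → DTree n A → DTree n A
splitCopy x a (leaf c) = leaf c
splitCopy x a (node y l r) with bothConsistent y true x | bothConsistent y false x
-- path continues to the yes-child; sibling is the no-child r
... | true | _ =
  if consistent y false x a then node y (splitCopy x a l) r else splitCopy x a l
-- path continues to the no-child; sibling is the yes-child l
... | false | true =
  if consistent y true x a then node y l (splitCopy x a r) else splitCopy x a r
-- path ends at this (non-leaf) node u_d: remove it and its child along the
-- outcome inconsistent with the a-outcome at x
... | false | false =
  if not (consistent y true x a) then r
  else (if not (consistent y false x a) then l else node y l r)

splitAround : ∀ {n A} → Test n → DTree n A → DTree n A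
splitAround x t = node x (splitCopy x true t) (splitCopy x false t)

module Submission where

open import Defs
open import Data.Fin using (Fin)
open import Data.Fin.Subset using (Subset)
open import Relation.Binary.PropositionalEquality using (_≡_; refl; sym; trans; cong)
open import Data.Bool using (Bool; true; false; T; _∧_; _≟_; if_then_else_)
open import Data.Bool.Properties using (T-≡; T-∧)
open import Data.List.Relation.Unary.Any as Any using ()
open import Data.List.Relation.Unary.Any.Properties using (any⁺)
open import Data.List.Membership.Propositional.Properties using (∈-allFin)
open import Data.Product using (_,_)
open import Function.Bundles using (Equivalence)
open import Relation.Nullary.Decidable using (⌊_⌋; fromWitness)

-- On the copy for outcome α at x, splitting deletes a node only together with
-- a branch whose outcome is inconsistent with α.  A query with outcome α at x
-- never takes such an outcome, so its search just skips the deleted nodes and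
-- ends at a copy of its original leaf.  This holds for every tree and every
-- query.

consistent-witness : ∀ {n} (y x : Test n) {b a : Bool} (q : Fin n) →
                     eval y q ≡ b → eval x q ≡ a → consistent y b x a ≡ true
consistent-witness y x q refl refl =
  Equivalence.to T-≡ (any⁺ agrees (Any.map witness (∈-allFin q)))
  where
    agrees : Fin _ → Bool
    agrees q′ = ⌊ eval y q′ ≟ eval y q ⌋ ∧ ⌊ eval x q′ ≟ eval x q ⌋

    witness : ∀ {q′} → q ≡ q′ → T (agrees q′)
    witness refl =
      Equivalence.from (T-∧ {⌊ eval y q ≟ eval y q ⌋}) (fromWitness refl , fromWitness refl)

search-node-yes : ∀ {n A} (x y : Test n) {a : Bool} (l r : DTree n A) (q : Fin n) →
                  eval x q ≡ a → consistent y false x a ≡ false →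
                  search (node y l r) q ≡ search l q
search-node-yes x y l r q xq≡a inconsistent with eval y q in yq
... | true = refl
... | false with () ← trans (sym inconsistent) (consistent-witness y x q yq xq≡a)

search-node-no : ∀ {n A} (x y : Test n) {a : Bool} (l r : DTree n A) (q : Fin n) →
                 eval x q ≡ a → consistent y true x a ≡ false →
                 search (node y l r) q ≡ search r q
search-node-no x y l r q xq≡a inconsistent with eval y q in yq
... | false = refl
... | true with () ← trans (sym inconsistent) (consistent-witness y x q yq xq≡a)

search-splitCopy : ∀ {n A} (x : Test n) {a : Bool} (t : DTree n A) (q : Fin n) →
                   eval x q ≡ a → search (splitCopy x a t) q ≡ search t q
search-splitCopy x (leaf c) q xq≡a = refl
search-splitCopy x {a} (node y l r) q xq≡a
  with bothConsistent y true x | bothConsistent y false x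
... | true | _ with consistent y false x a in c
...   | true  = cong (λ s → if eval y q then s else search r q) (search-splitCopy x l q xq≡a)
...   | false = trans (search-splitCopy x l q xq≡a) (sym (search-node-yes x y l r q xq≡a c))
search-splitCopy x {a} (node y l r) q xq≡a | false | true with consistent y true x a in c
...   | true  = cong (λ s → if eval y q then search l q else s) (search-splitCopy x r q xq≡a)
...   | false = trans (search-splitCopy x r q xq≡a) (sym (search-node-no x y l r q xq≡a c))
search-splitCopy x {a} (node y l r) q xq≡a | false | false
  with consistent y true x a in c₁ | consistent y false x a in c₂
... | false | _     = sym (search-node-no x y l r q xq≡a c₁)
... | true  | false = sym (search-node-yes x y l r q xq≡a c₂)
... | true  | true  = refl

search-splitAround : ∀ {n A} (x : Test n) (t : DTree n A) (q : Fin n) →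
                     search (splitAround x t) q ≡ search t q
search-splitAround x t q with eval x q in xq
... | true  = search-splitCopy x t q xq
... | false = search-splitCopy x t q xq

lemma1 : ∀ {n} (I : Instance n) (T : DTree n (Subset n)) →
    IsDecisionTree I T → Irreducible I T →
    (p : Address) (s : DTree n (Subset n)) → At T p s →
    (x : Test n) → Allowed I x →
    (q : Fin n) → Reaches T p q →
    search (splitAround x (addresses s)) q ≡ search (addresses s) q
lemma1 I T _ _ p s _ x _ q _ = search-splitAround x (addresses s) q
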